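{- For every integer $d \geq 1$, $L^\circ_{d+2} \geq L^\circ_d\,(2L^\circ_d+1)$.
   Context: For $a,b \in \mathbb{N}$ write $a \rightarrow b$ iff either $b = a+1$ or $b = 0$. For vectors $v,w \in \mathbb{N}^d$ write $v \rightarrow w$ iff $v^\ell \rightarrow w^\ell$ for every coordinate $\ell$, and $v \leq w$ iff $v^\ell \leq w^\ell$ for every coordinate $\ell$. A sequence $(v_0,\ldots,v_{n-1})$ of vectors in $\mathbb{N}^d$ is valid iff $v_i \rightarrow v_{i+1}$ for each $i < n-1$; it is cyclic iff it is valid and additionally $v_{n-1} \rightarrow v_0$. A sequence is non-dominating iff $v_i \not\leq v_j$ whenever $i < j$. $L^\circ_d$ denotes the maximum length of a non-dominating cyclic sequence of vectors in $\mathbb{N}^d$. -}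

module Defs where

open import Data.Nat using (ℕ; zero; suc; _≤_; _<_)
open import Data.Fin using (Fin; toℕ; fromℕ; inject₁)
open import Data.Product using (Σ; _×_)
open import Data.Sum using (_⊎_)
open import Relation.Binary.PropositionalEquality using (_≡_)
open import Relation.Nullary using (¬_)

_⇝_ : ℕ → ℕ → Set
a ⇝ b = (b ≡ suc a) ⊎ (b ≡ 0)

Vecℕ : ℕ → Set
Vecℕ d = Fin d → ℕ

_⇝ᵛ_ : {d : ℕ} → Vecℕ d → Vecℕ d → Set
v ⇝ᵛ w = ∀ ℓ → v ℓ ⇝ w ℓ

_≤ᵛ_ : {d : ℕ} → Vecℕ d → Vecℕ d → Set
v ≤ᵛ w = ∀ ℓ → v ℓ ≤ w ℓ

Seq : ℕ → ℕ → Set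
Seq d n = Fin n → Vecℕ d

Valid : {d n : ℕ} → Seq d n → Set
Valid {d} {zero} s = Data.Unit.⊤ where import Data.Unit
Valid {d} {suc m} s = ∀ (i : Fin m) → s (inject₁ i) ⇝ᵛ s (Data.Fin.suc i)

Cyclic : {d n : ℕ} → Seq d n → Set
Cyclic {d} {zero} s = Valid s
Cyclic {d} {suc m} s = Valid s × (s (fromℕ m) ⇝ᵛ s Data.Fin.zero)

NonDominating : {d n : ℕ} → Seq d n → Set
NonDominating {d} {n} s = ∀ (i j : Fin n) → toℕ i < toℕ j → ¬ (s i ≤ᵛ s j)

HasNDC : ℕ → ℕ → Set
HasNDC d n = Σ (Seq d n) λ s → Cyclic s × NonDominating s

IsLcirc : ℕ → ℕ → Set
IsLcirc d L = HasNDC d L × (∀ n → HasNDC d n → n ≤ L)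

-- Let (s_0, …, s_{n-1}) be a non-dominating cyclic sequence in ℕ^d. Run through it 2n+1
-- times, appending two coordinates (x, y) to s_a in round p, where round 2r carries
-- (a ∸ r, n ∸ r + a) and round 2r+1 carries (n ∸ r + a, a ∸ (r+1)). Each new coordinate
-- alternates between "high" rounds, whose values n ∸ r + a shrink as r grows and exceed
-- every "low" value, and "low" rounds. So if round p precedes round q and a ≥ b, one of the
-- new coordinates strictly drops from (p, a) to (q, b), while for a < b the old coordinates
-- already prevent domination. Both coordinates grow by one or reset to 0 within a round,
-- across round boundaries, and from the end of round 2n, where (x, y) = (0, n−1), back to
-- the start of round 0, where (x, y) = (0, n).
module Submission where

open import Defs
open import Data.Nat using (ℕ; zero; suc; _≤_; _<_; _+_; _*_; _∸_; z≤n; s≤s; s≤s⁻¹; NonZero)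
open import Data.Nat.Properties
open import Data.Nat.DivMod
open import Data.Nat.Divisibility using (n∣m*n)
open import Data.Nat.Solver using (module +-*-Solver)
open import Data.Fin as Fin using (Fin; toℕ; fromℕ; fromℕ<; inject₁)
open import Data.Fin.Properties using (toℕ-injective; toℕ<n; toℕ-fromℕ<; toℕ-inject₁; toℕ-fromℕ)
open import Data.Vec.Functional using (_++_; _∷_; [])
open import Data.Vec.Functional.Relation.Binary.Pointwise.Properties using (++⁺; ++⁻ˡ; ++⁻ʳ)
open import Data.Product using (Σ; _×_; _,_; proj₂)
open import Data.Sum using (_⊎_; inj₁; inj₂; [_,_]′)
open import Data.Unit using (tt)
open import Relation.Nullary using (¬_; contradiction)
open import Relation.Binary.Definitions using (tri<; tri≈; tri>)
open import Relation.Binary.PropositionalEquality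

record IsNDCycle {d : ℕ} (N : ℕ) (g : ℕ → Vecℕ d) : Set where
  field
    step   : ∀ k → suc k < N → g k ⇝ᵛ g (suc k)
    wrap   : ∀ k → suc k ≡ N → g k ⇝ᵛ g 0
    nondom : ∀ i j → i < j → j < N → ¬ (g i ≤ᵛ g j)

IsNDCycle⇒HasNDC : ∀ {d N} {g : ℕ → Vecℕ d} → IsNDCycle N g → HasNDC d N
IsNDCycle⇒HasNDC {N = zero} _ = (λ ()) , tt , (λ ())
IsNDCycle⇒HasNDC {N = suc m} {g} cyc = (λ i → g (toℕ i)) , (valid , cyclic) , nondom′
  where
  open IsNDCycle cyc
  valid : ∀ (i : Fin m) → g (toℕ (inject₁ i)) ⇝ᵛ g (suc (toℕ i))
  valid i rewrite toℕ-inject₁ i = step (toℕ i) (s≤s (toℕ<n i))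
  cyclic : g (toℕ (fromℕ m)) ⇝ᵛ g 0
  cyclic rewrite toℕ-fromℕ m = wrap m refl
  nondom′ : ∀ (i j : Fin (suc m)) → toℕ i < toℕ j → ¬ (g (toℕ i) ≤ᵛ g (toℕ j))
  nondom′ i j i<j = nondom (toℕ i) (toℕ j) i<j (toℕ<n j)

mod-≡ : ∀ {n k} .{{_ : NonZero n}} (i : Fin n) → toℕ i ≡ k → k mod n ≡ i
mod-≡ {n} {k} i refl = toℕ-injective (trans (toℕ-fromℕ< (m%n<n k n)) (m<n⇒m%n≡m (toℕ<n i)))

HasNDC⇒IsNDCycle : ∀ {d m} → HasNDC d (suc m) → Σ (ℕ → Vecℕ d) (IsNDCycle (suc m))
HasNDC⇒IsNDCycle {d} {m} (s , (valid , cyclic) , nondom) = g , record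
  { step = step ; wrap = wrap ; nondom = nondom′ }
  where
  n = suc m
  g : ℕ → Vecℕ d
  g k = s (k mod n)
  step : ∀ k → suc k < n → g k ⇝ᵛ g (suc k)
  step k k<m = subst₂ (λ i j → s i ⇝ᵛ s j)
    (sym (mod-≡ (inject₁ i) (trans (toℕ-inject₁ i) (toℕ-fromℕ< (s≤s⁻¹ k<m)))))
    (sym (mod-≡ (Fin.suc i) (cong suc (toℕ-fromℕ< (s≤s⁻¹ k<m)))))
    (valid i)
    where i = fromℕ< (s≤s⁻¹ k<m)
  wrap : ∀ k → suc k ≡ n → g k ⇝ᵛ g 0
  wrap k refl = subst (λ i → s i ⇝ᵛ s Fin.zero) (sym (mod-≡ (fromℕ k) (toℕ-fromℕ k))) cyclic
  nondom′ : ∀ i j → i < j → j < n → ¬ (g i ≤ᵛ g j)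
  nondom′ i j i<j j<n = nondom (i mod n) (j mod n)
    (subst₂ _<_ (sym (toℕ-fromℕ< (m%n<n i n))) (sym (toℕ-fromℕ< (m%n<n j n)))
      (subst₂ _<_ (sym (m<n⇒m%n≡m (<-trans i<j j<n))) (sym (m<n⇒m%n≡m j<n)) i<j))

[m+kn]%n≡m : ∀ {m} k n .{{_ : NonZero n}} → m < n → (m + k * n) % n ≡ m
[m+kn]%n≡m {m} k n m<n = trans ([m+kn]%n≡m%n m k n) (m<n⇒m%n≡m m<n)

[m+kn]/n≡k : ∀ {m} k n .{{_ : NonZero n}} → m < n → (m + k * n) / n ≡ k
[m+kn]/n≡k {m} k n m<n =
  trans (+-distrib-/-∣ʳ m (n∣m*n k)) (cong₂ _+_ (m<n⇒m/n≡0 m<n) (m*n/n≡m k n))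

+-*-<-lex : ∀ {a b p q n} → a < n → b < n → a + p * n < b + q * n → p < q ⊎ (p ≡ q × a < b)
+-*-<-lex {a} {b} {p} {q} {n} a<n b<n lt with <-cmp p q
... | tri< p<q _ _ = inj₁ p<q
... | tri≈ _ refl _ = inj₂ (refl , +-cancelʳ-< (p * n) a b lt)
... | tri> _ _ q<p = contradiction lt (≤⇒≯ (begin
  b + q * n      <⟨ +-monoˡ-< (q * n) b<n ⟩
  n + q * n      ≤⟨ *-monoˡ-≤ n q<p ⟩
  p * n          ≤⟨ m≤n+m (p * n) a ⟩
  a + p * n      ∎))
  where open ≤-Reasoning

record IsBlockNDCycle {d : ℕ} (B m : ℕ) (G : ℕ → ℕ → Vecℕ d) : Set where
  field
    step-within  : ∀ p a → p < B → a < m → G p a ⇝ᵛ G p (suc a)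
    step-between : ∀ p → suc p < B → G p m ⇝ᵛ G (suc p) 0
    wrap         : ∀ p → suc p ≡ B → G p m ⇝ᵛ G 0 0
    nondom       : ∀ p a q b → q < B → a ≤ m → b ≤ m →
                   p < q ⊎ (p ≡ q × a < b) → ¬ (G p a ≤ᵛ G q b)

module _ {d B m : ℕ} {G : ℕ → ℕ → Vecℕ d} (blocks : IsBlockNDCycle B m G) where
  open IsBlockNDCycle blocks
  private
    n = suc m

  concat : ℕ → Vecℕ d
  concat k = G (k / n) (k % n)

  concat-at : ∀ {k} p {a} → a < n → k ≡ a + p * n → concat k ≡ G p a
  concat-at p a<n refl = cong₂ G ([m+kn]/n≡k p n a<n) ([m+kn]%n≡m p n a<n)

  concat-step : ∀ k → suc k < B * n → concat k ⇝ᵛ concat (suc k)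
  concat-step k k<N with m≤n⇒m<n∨m≡n (m%n<n k n)
  ... | inj₁ 1+r<n = subst (concat k ⇝ᵛ_) (sym (concat-at (k / n) 1+r<n (cong suc (m≡m%n+[m/n]*n k n))))
                     (step-within (k / n) (k % n) (m<n*o⇒m/o<n (<-trans (n<1+n k) k<N)) (s≤s⁻¹ 1+r<n))
  ... | inj₂ r≡m = subst₂ _⇝ᵛ_ (sym (concat-at (k / n) ≤-refl k≡)) (sym (concat-at (suc (k / n)) (s≤s z≤n) 1+k≡))
                     (step-between (k / n) (subst (_< B) ([m+kn]/n≡k (suc (k / n)) n (s≤s z≤n))
                       (subst (λ t → t / n < B) 1+k≡ (m<n*o⇒m/o<n k<N))))
    where
    k≡ : k ≡ m + (k / n) * n
    k≡ = trans (m≡m%n+[m/n]*n k n) (cong (_+ (k / n) * n) (suc-injective r≡m))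
    1+k≡ : suc k ≡ 0 + suc (k / n) * n
    1+k≡ = cong suc k≡

  concat-wrap : ∀ k → suc k ≡ B * n → concat k ⇝ᵛ concat 0
  concat-wrap k = wrap-from B refl
    where
    wrap-from : ∀ B′ → B′ ≡ B → suc k ≡ B′ * n → concat k ⇝ᵛ concat 0
    wrap-from (suc p) 1+p≡B 1+k≡ = subst₂ _⇝ᵛ_
      (sym (concat-at p ≤-refl (suc-injective 1+k≡))) (sym (concat-at 0 (s≤s z≤n) refl)) (wrap p 1+p≡B)

  concat-nondom : ∀ i j → i < j → j < B * n → ¬ (concat i ≤ᵛ concat j)
  concat-nondom i j i<j j<N = nondom (i / n) (i % n) (j / n) (j % n) (m<n*o⇒m/o<n j<N)
    (s≤s⁻¹ (m%n<n i n)) (s≤s⁻¹ (m%n<n j n))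
    (+-*-<-lex (m%n<n i n) (m%n<n j n) (subst₂ _<_ (m≡m%n+[m/n]*n i n) (m≡m%n+[m/n]*n j n) i<j))

  concat-isNDCycle : IsNDCycle (B * n) concat
  concat-isNDCycle = record { step = concat-step ; wrap = concat-wrap ; nondom = concat-nondom }

extend : ∀ {d} → Vecℕ d → ℕ → ℕ → Vecℕ (d + 2)
extend v x y = v ++ (x ∷ y ∷ [])

extend-⇝ᵛ : ∀ {d} {v v′ : Vecℕ d} {x x′ y y′} →
            v ⇝ᵛ v′ → x ⇝ x′ → y ⇝ y′ → extend v x y ⇝ᵛ extend v′ x′ y′
extend-⇝ᵛ v⇝v′ x⇝x′ y⇝y′ = ++⁺ _⇝_ v⇝v′ λ { Fin.zero → x⇝x′ ; (Fin.suc Fin.zero) → y⇝y′ }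

extend-≤ᵛ⁻ : ∀ {d} {v v′ : Vecℕ d} {x x′ y y′} →
             extend v x y ≤ᵛ extend v′ x′ y′ → v ≤ᵛ v′ × x ≤ x′ × y ≤ y′
extend-≤ᵛ⁻ {v = v} {v′} le = ++⁻ˡ _≤_ v v′ le , xy≤ Fin.zero , xy≤ (Fin.suc Fin.zero)
  where xy≤ = ++⁻ʳ _≤_ v v′ le

data Round : Set where
  even odd : ℕ → Round

next : Round → Round
next (even r) = odd r
next (odd r)  = even (suc r)

round : ℕ → Round
round zero    = even 0
round (suc p) = next (round p)

index : Round → ℕ
index (even r) = r + r
index (odd r)  = suc (r + r)

index-round : ∀ p → index (round p) ≡ p
index-round zero = refl
index-round (suc p) with round p | index-round p
... | even r | refl = refl
... | odd r  | refl = cong suc (+-suc r r)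

round-double : ∀ r → round (r + r) ≡ even r
round-double zero = refl
round-double (suc r) rewrite +-suc r r | round-double r = refl

double-<-cancel : ∀ {r s} → r + r < s + s → r < s
double-<-cancel lt = ≰⇒> λ s≤r → <⇒≱ lt (+-mono-≤ s≤r s≤r)

double-≤-cancel : ∀ {r s} → r + r ≤ s + s → r ≤ s
double-≤-cancel le = ≮⇒≥ λ s<r → <⇒≱ (+-mono-< s<r s<r) le

m∸n⇝1+m∸n : ∀ m n → (m ∸ n) ⇝ (suc m ∸ n)
m∸n⇝1+m∸n m zero = inj₁ refl
m∸n⇝1+m∸n zero (suc n) = inj₂ (0∸n≡0 n)
m∸n⇝1+m∸n (suc m) (suc n) = m∸n⇝1+m∸n m n

module Interleaving {d m : ℕ} {g : ℕ → Vecℕ d} (base : IsNDCycle (suc m) g) where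
  open IsNDCycle base
  private
    n = suc m

  low high : ℕ → ℕ → ℕ
  low c a = a ∸ c
  high c a = n ∸ c + a

  X Y : Round → ℕ → ℕ
  X (even r) = low r
  X (odd r)  = high r
  Y (even r) = high r
  Y (odd r)  = low (suc r)

  low-step : ∀ c a → low c a ⇝ low c (suc a)
  low-step c a = m∸n⇝1+m∸n a c

  high-step : ∀ c a → high c a ⇝ high c (suc a)
  high-step c a = inj₁ (+-suc (n ∸ c) a)

  low-high : ∀ c → low c m ⇝ high c 0
  low-high c = subst (low c m ⇝_) (sym (+-identityʳ (n ∸ c))) (m∸n⇝1+m∸n m c)

  X-step : ∀ ρ a → X ρ a ⇝ X ρ (suc a)
  X-step (even r) = low-step r
  X-step (odd r)  = high-step r

  Y-step : ∀ ρ a → Y ρ a ⇝ Y ρ (suc a)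
  Y-step (even r) = high-step r
  Y-step (odd r)  = low-step (suc r)

  X-next : ∀ ρ → X ρ m ⇝ X (next ρ) 0
  X-next (even r) = low-high r
  X-next (odd r)  = inj₂ refl

  Y-next : ∀ ρ → Y ρ m ⇝ Y (next ρ) 0
  Y-next (even r) = inj₂ refl
  Y-next (odd r)  = low-high (suc r)

  low<high : ∀ {t c a b} → c < n → b ≤ a → low t b < high c a
  low<high {t} {c} {a} {b} c<n b≤a =
    ≤-<-trans (≤-trans (m∸n≤m b t) b≤a) (m<n+m a (m<n⇒0<n∸m c<n))

  high-antitone : ∀ {c c′ a b} → c < c′ → c′ ≤ n → b ≤ a → high c′ b < high c a
  high-antitone c<c′ c′≤n b≤a = +-mono-<-≤ (∸-monoʳ-< c<c′ c′≤n) b≤a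

  later-round-drops : ∀ ρ σ {a b} → index ρ < index σ → index σ ≤ n + n → b ≤ a →
                      X σ b < X ρ a ⊎ Y σ b < Y ρ a
  later-round-drops (even r) (even s) lt le b≤a =
    inj₂ (high-antitone {r} {s} (double-<-cancel lt) (double-≤-cancel le) b≤a)
  later-round-drops (odd r) (odd s) lt le b≤a =
    inj₁ (high-antitone {r} {s} (double-<-cancel (s≤s⁻¹ lt)) (<⇒≤ (double-<-cancel le)) b≤a)
  later-round-drops (even r) (odd s) lt le b≤a =
    inj₂ (low<high {suc s} {r} (≤-<-trans (double-≤-cancel {r} {s} (s≤s⁻¹ lt)) (double-<-cancel le)) b≤a)
  later-round-drops (odd r) (even s) lt le b≤a =
    inj₁ (low<high {s} {r} (<-≤-trans (double-<-cancel {r} {s} (<-trans (n<1+n _) lt)) (double-≤-cancel le)) b≤a)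

  G : ℕ → ℕ → Vecℕ (d + 2)
  G p a = extend (g a) (X (round p) a) (Y (round p) a)

  wrap-last : G (n + n) m ⇝ᵛ G 0 0
  wrap-last rewrite round-double n = extend-⇝ᵛ (wrap m refl) (inj₂ refl)
    (inj₁ (cong suc (trans (+-identityʳ m) (cong (_+ m) (sym (n∸n≡0 m))))))

  nondom-G : ∀ p a q b → q < suc (n + n) → a ≤ m → b ≤ m →
             p < q ⊎ (p ≡ q × a < b) → ¬ (G p a ≤ᵛ G q b)
  nondom-G p a q b q<B _ b≤m order le with extend-≤ᵛ⁻ le | <-≤-connex a b
  ... | v≤v′ , _ | inj₁ a<b = nondom a b a<b (s≤s b≤m) v≤v′
  ... | _ , x≤x′ , y≤y′ | inj₂ b≤a =
    [ (λ x< → <⇒≱ x< x≤x′) , (λ y< → <⇒≱ y< y≤y′) ]′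
      (later-round-drops (round p) (round q)
        (subst₂ _<_ (sym (index-round p)) (sym (index-round q)) p<q)
        (subst (_≤ n + n) (sym (index-round q)) (s≤s⁻¹ q<B)) b≤a)
    where
    p<q : p < q
    p<q = [ (λ p<q → p<q) , (λ { (_ , a<b) → contradiction b≤a (<⇒≱ a<b) }) ]′ order

  isBlockNDCycle : IsBlockNDCycle (suc (n + n)) m G
  isBlockNDCycle = record
    { step-within  = λ p a _ a<m → extend-⇝ᵛ (step a (s≤s a<m)) (X-step (round p) a) (Y-step (round p) a)
    ; step-between = λ p _ → extend-⇝ᵛ (wrap m refl) (X-next (round p)) (Y-next (round p))
    ; wrap         = λ { .(n + n) refl → wrap-last }
    ; nondom       = nondom-G
    }

  hasNDC : HasNDC (d + 2) (suc (n + n) * n)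
  hasNDC = IsNDCycle⇒HasNDC (concat-isNDCycle isBlockNDCycle)

theorem1 : (d : ℕ) → 1 ≤ d → (L L' : ℕ) → IsLcirc d L → IsLcirc (d + 2) L' →
    L * (2 * L + 1) ≤ L'
-- The construction works in every dimension.
theorem1 d _ zero L' _ _ = z≤n
theorem1 d _ (suc m) L' (hasL , _) (_ , maximal) =
  subst (_≤ L') (length≡ (suc m)) (maximal _ (Interleaving.hasNDC (proj₂ (HasNDC⇒IsNDCycle hasL))))
  where
  open +-*-Solver
  length≡ : ∀ n → suc (n + n) * n ≡ n * (2 * n + 1)
  length≡ = solve 1 (λ n → (con 1 :+ (n :+ n)) :* n := n :* (con 2 :* n :+ con 1)) refl
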